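{- Let $p$ be an odd prime and let $(G,\boldsymbol{\gamma})$ be a $\mathbb{Z}/p\mathbb{Z}$-colored graph. Let $(H,\boldsymbol{\gamma})$ be obtained from $(G,\boldsymbol{\gamma})$ by an \textbf{(H2c)} move that adds a new vertex $n$, removes an edge $ab$ with color $\gamma_{ab}$, and adds new edges $an$, $bn$, $cn$ with colors satisfying $\gamma_{an}-\gamma_{bn}=\gamma_{ab}$. Then the symmetric lift $\tilde H$ is obtained from the symmetric lift $\tilde G$ by applying $p$ uncolored \textbf{(H2)} moves, one for each edge in the fiber over $ab$.
   Context: A $\mathbb{Z}/p\mathbb{Z}$-colored graph is a finite directed multigraph $G=(V,E)$ with a color $\gamma_e\in\mathbb{Z}/p\mathbb{Z}$ on each edge. The symmetric lift $\tilde G$ is the undirected multigraph with vertices $\tilde i_\delta$ ($i\in V$, $\delta\in\mathbb{Z}/p\mathbb{Z}$). For each directed edge $ij$ of color $\gamma_{ij}$ and each $\delta$, it has an edge $\tilde i_\delta\tilde j_{\delta+\gamma_{ij}}$; these $p$ edges form the fiber over $ij$. The \textbf{(H2c)} move chooses an edge $ab$ with color $\gamma_{ab}$ and a vertex $c$, where $a,b,c$ are not necessarily distinct. It removes $ab$, adds a new vertex $n$ and edges $an,bn,cn$ oriented into $n$ with $\gamma_{an}-\gamma_{bn}=\gamma_{ab}$ and $\gamma_{cn}$ arbitrary. If any of $a,b,c$ coincide, the parallel edges added must have pairwise different colors. An uncolored \textbf{(H2)} move on an undirected graph removes an edge $xy$, adds a new vertex $w$, and adds edges $wx$, $wy$,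 $wz$ for some existing vertex $z$. -}

module Defs where

open import Data.Nat using (ℕ; suc; _+_; _*_; NonZero)
open import Data.Nat.DivMod using (_mod_)
open import Data.Fin using (Fin; toℕ; fromℕ; inject₁; combine)
open import Data.Product using (_×_; _,_; Σ; ∃)
open import Data.Sum using (_⊎_)
open import Data.List using (List; []; _∷_; map; _++_; concatMap; allFin)
open import Data.List.Membership.Propositional using (_∈_)
open import Data.List.Relation.Unary.Any using (_─_)
open import Data.List.Relation.Binary.Pointwise using (Pointwise)
open import Data.List.Relation.Binary.Permutation.Propositional using (_↭_)
open import Function.Bundles using (_↔_; Inverse)
open import Relation.Binary.PropositionalEquality using (_≡_)

_⊕_ : {p : ℕ} .{{_ : NonZero p}} → Fin p → Fin p → Fin p
_⊕_ {p} x y = (toℕ x + toℕ y) mod p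

-- ℤ/pℤ-colored graphs: finite directed multigraphs with vertex set Fin nV
-- and a list of directed colored edges (source , target , color).

record CGraph (p : ℕ) : Set where
  constructor cgraph
  field
    nV    : ℕ
    edges : List (Fin nV × Fin nV × Fin p)
open CGraph public

-- Undirected multigraphs: vertex set Fin nV, edges a list of (unordered)
-- pairs; the order of the two endpoints in a stored pair is irrelevant
-- (see UEdgeEq / Iso below).

record UGraph : Set where
  constructor ugraph
  field
    nV    : ℕ
    edges : List (Fin nV × Fin nV)
open UGraph public

-- Symmetric lift. The vertex ĩ_δ is  combine i δ : Fin (nV * p).
-- For each directed edge ij of color γ and each δ there is an edge
-- ĩ_δ j̃_{δ+γ}.

fiber : {p n : ℕ} .{{_ : NonZero p}} → Fin n → Fin n → Fin p
      → List (Fin (n * p) × Fin (n * p))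
fiber {p} a b γ = map (λ δ → (combine a δ , combine b (δ ⊕ γ))) (allFin p)

liftEdge : {p n : ℕ} .{{_ : NonZero p}} → Fin n × Fin n × Fin p
         → List (Fin (n * p) × Fin (n * p))
liftEdge (i , j , γ) = fiber i j γ

lift : {p : ℕ} .{{_ : NonZero p}} → CGraph p → UGraph
lift {p} G = ugraph (CGraph.nV G * p) (concatMap liftEdge (CGraph.edges G))

-- The (H2c) move. The removed edge ab is given by a membership proof
-- (a position in the edge list); the new vertex n is  fromℕ nV, old
-- vertices are embedded by inject₁.

H2c : {p : ℕ} (G : CGraph p) {a b : Fin (CGraph.nV G)} {γab : Fin p}
      → (a , b , γab) ∈ CGraph.edges G → (c : Fin (CGraph.nV G))
      → (γan γbn γcn : Fin p) → CGraph p
H2c {p} G {a} {b} e c γan γbn γcn =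
  cgraph (suc (CGraph.nV G))
    (map (λ { (i , j , γ) → (inject₁ i , inject₁ j , γ) }) (CGraph.edges G ─ e)
     ++ (inject₁ a , new , γan) ∷ (inject₁ b , new , γbn) ∷ (inject₁ c , new , γcn) ∷ [])
  where new = fromℕ (CGraph.nV G)

injE : {n : ℕ} → Fin n × Fin n → Fin (suc n) × Fin (suc n)
injE (x , y) = (inject₁ x , inject₁ y)

H2 : (G : UGraph) {x y : Fin (UGraph.nV G)}
     → (x , y) ∈ UGraph.edges G → (z : Fin (UGraph.nV G)) → UGraph
H2 G {x} {y} e z =
  ugraph (suc (UGraph.nV G))
    (map injE (UGraph.edges G ─ e)
     ++ (w , inject₁ x) ∷ (w , inject₁ y) ∷ (w , inject₁ z) ∷ [])
  where w = fromℕ (UGraph.nV G)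

-- H2Moves G rs G' : G' is obtained from G by a sequence of (H2) moves,
-- the removed edges being (in order) the list rs, written in the vertex
-- labelling of G (old vertices keep their labels, via inject₁).
data H2Moves : (G : UGraph) → List (Fin (UGraph.nV G) × Fin (UGraph.nV G)) → UGraph → Set where
  done : ∀ {G} → H2Moves G [] G
  step : ∀ {G G' x y} (e : (x , y) ∈ UGraph.edges G) (z : Fin (UGraph.nV G))
         (rs : List (Fin (UGraph.nV G) × Fin (UGraph.nV G)))
         → H2Moves (H2 G e z) (map injE rs) G'
         → H2Moves G ((x , y) ∷ rs) G'

UEdgeEq : {n : ℕ} → Fin n × Fin n → Fin n × Fin n → Set
UEdgeEq (x , y) (x' , y') = ((x ≡ x') × (y ≡ y')) ⊎ ((x ≡ y') × (y ≡ x'))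

Iso : UGraph → UGraph → Set
Iso G H =
  Σ (Fin (UGraph.nV G) ↔ Fin (UGraph.nV H)) λ φ →
    let f = Inverse.to φ in
    ∃ λ es → Pointwise UEdgeEq (map (λ { (x , y) → (f x , f y) }) (UGraph.edges G)) es
             × (es ↭ UGraph.edges H)

-- The η-th (H2) move (η ∈ ℤ/p) removes the edge ã_{η−γan} b̃_{η−γbn}, which lies in the fiber over
-- ab precisely because γan − γbn = γab, and joins its new vertex to ã_{η−γan}, b̃_{η−γbn}, c̃_{η−γcn}:
-- exactly the neighbours of ñ_η in the lift of H. As η ranges over ℤ/p the removed edges run through
-- the whole fiber, and sending the η-th new vertex to ñ_η and every old vertex to itself is an
-- isomorphism onto the lift of H.

module Submission where

open import Defs
open import Data.Nat using (ℕ; NonZero; zero; suc; _+_; _*_; _∸_; _%_)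
open import Data.Nat.Properties using (+-assoc; +-comm; *-comm; m+[n∸m]≡n; m∸n+n≡m; <⇒≤)
open import Data.Nat.DivMod using (_mod_; %-distribˡ-+; m%n%n≡m%n; [m+n]%n≡m%n; m<n⇒m%n≡m)
open import Data.Nat.Primality using (Prime)
open import Data.Nat.Divisibility using (_∣_)
open import Data.Fin using (Fin; zero; suc; toℕ; fromℕ; inject₁; combine; punchIn; _↑ˡ_; _↑ʳ_)
open import Data.Fin.Properties
  using (toℕ-injective; toℕ<n; toℕ-fromℕ<; toℕ-fromℕ; toℕ-inject₁; toℕ-cast; toℕ-↑ˡ; toℕ-↑ʳ; toℕ-combine; +↔⊎)
open import Data.Fin.Relation.Unary.Top using (View; ‵fromℕ; ‵inj₁; view; view-fromℕ; view-inject₁)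
open import Data.Fin.Permutation using (Permutation′; _⟨$⟩ʳ_; remove; punchIn-permute; permutation; cast-id)
open import Data.Product using (_×_; _,_; ∃; swap)
open import Data.Sum using (_⊎_; inj₁; inj₂)
open import Data.List using (List; []; _∷_; [_]; map; _++_; concat; concatMap; tabulate; allFin)
open import Data.List.Properties
  using (map-++; map-∘; map-id; map-cong; ++-identityʳ; ++-assoc; concat-map; concatMap-++; map-tabulate; tabulate-cong)
open import Data.List.Membership.Propositional using (_∈_)
open import Data.List.Relation.Unary.Any using (here; there; _─_)
open import Data.List.Relation.Binary.Pointwise as Pointwise using (Pointwise; _∷_)
open import Data.List.Relation.Binary.Permutation.Propositional as ↭
  using (_↭_; ↭-refl; ↭-sym; ↭-trans; ↭-reflexive)
open import Data.List.Relation.Binary.Permutation.Propositional.Properties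
  using (++⁺ˡ; ++⁺ʳ; ++⁺; shifts; drop-∷; ∈-resp-↭; map⁺)
open import Function using (_∘_; id)
open import Function.Bundles using (_↔_; Inverse; mk↔ₛ′)
open import Function.Construct.Composition using (_↔-∘_)
open import Function.Properties.Inverse using (↔-sym)
open import Relation.Nullary using (¬_)
open import Relation.Binary.PropositionalEquality
  using (_≡_; _≢_; refl; sym; trans; cong; cong₂; subst; module ≡-Reasoning)

module _ {p : ℕ} .{{_ : NonZero p}} where

  infixl 6 _⊖_

  _⊖_ : Fin p → Fin p → Fin p
  x ⊖ y = (toℕ x + (p ∸ toℕ y)) mod p

  toℕ-⊕ : ∀ x y → toℕ (x ⊕ y) ≡ (toℕ x + toℕ y) % p
  toℕ-⊕ x y = toℕ-fromℕ< _

  toℕ-⊖ : ∀ x y → toℕ (x ⊖ y) ≡ (toℕ x + (p ∸ toℕ y)) % p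
  toℕ-⊖ x y = toℕ-fromℕ< _

  [m%p+n]%p≡[m+n]%p : ∀ m n → (m % p + n) % p ≡ (m + n) % p
  [m%p+n]%p≡[m+n]%p m n = begin
    (m % p + n) % p            ≡⟨ %-distribˡ-+ (m % p) n p ⟩
    (m % p % p + n % p) % p    ≡⟨ cong (λ t → (t + n % p) % p) (m%n%n≡m%n m p) ⟩
    (m % p + n % p) % p        ≡⟨ %-distribˡ-+ m n p ⟨
    (m + n) % p                ∎
    where open ≡-Reasoning

  [m+n%p]%p≡[m+n]%p : ∀ m n → (m + n % p) % p ≡ (m + n) % p
  [m+n%p]%p≡[m+n]%p m n = begin
    (m + n % p) % p  ≡⟨ cong (_% p) (+-comm m (n % p)) ⟩
    (n % p + m) % p  ≡⟨ [m%p+n]%p≡[m+n]%p n m ⟩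
    (n + m) % p      ≡⟨ cong (_% p) (+-comm n m) ⟩
    (m + n) % p      ∎
    where open ≡-Reasoning

  ⊕-assoc : ∀ x y z → (x ⊕ y) ⊕ z ≡ x ⊕ (y ⊕ z)
  ⊕-assoc x y z = toℕ-injective (begin
    toℕ ((x ⊕ y) ⊕ z)                  ≡⟨ toℕ-⊕ (x ⊕ y) z ⟩
    (toℕ (x ⊕ y) + toℕ z) % p          ≡⟨ cong (λ t → (t + toℕ z) % p) (toℕ-⊕ x y) ⟩
    ((toℕ x + toℕ y) % p + toℕ z) % p  ≡⟨ [m%p+n]%p≡[m+n]%p (toℕ x + toℕ y) (toℕ z) ⟩
    (toℕ x + toℕ y + toℕ z) % p        ≡⟨ cong (_% p) (+-assoc (toℕ x) (toℕ y) (toℕ z)) ⟩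
    (toℕ x + (toℕ y + toℕ z)) % p      ≡⟨ [m+n%p]%p≡[m+n]%p (toℕ x) (toℕ y + toℕ z) ⟨
    (toℕ x + (toℕ y + toℕ z) % p) % p  ≡⟨ cong (λ t → (toℕ x + t) % p) (toℕ-⊕ y z) ⟨
    (toℕ x + toℕ (y ⊕ z)) % p          ≡⟨ toℕ-⊕ x (y ⊕ z) ⟨
    toℕ (x ⊕ (y ⊕ z))                  ∎)
    where open ≡-Reasoning

  private
    [[x+m]%p+n]%p≡x : (x : Fin p) (m n : ℕ) → m + n ≡ p → ((toℕ x + m) % p + n) % p ≡ toℕ x
    [[x+m]%p+n]%p≡x x m n m+n≡p = begin
      ((toℕ x + m) % p + n) % p  ≡⟨ [m%p+n]%p≡[m+n]%p (toℕ x + m) n ⟩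
      (toℕ x + m + n) % p        ≡⟨ cong (_% p) (trans (+-assoc (toℕ x) m n) (cong (toℕ x +_) m+n≡p)) ⟩
      (toℕ x + p) % p            ≡⟨ [m+n]%n≡m%n (toℕ x) p ⟩
      toℕ x % p                  ≡⟨ m<n⇒m%n≡m (toℕ<n x) ⟩
      toℕ x                      ∎
      where open ≡-Reasoning

  ⊕-⊖-cancel : ∀ x y → (x ⊕ y) ⊖ y ≡ x
  ⊕-⊖-cancel x y = toℕ-injective (begin
    toℕ ((x ⊕ y) ⊖ y)                          ≡⟨ toℕ-⊖ (x ⊕ y) y ⟩
    (toℕ (x ⊕ y) + (p ∸ toℕ y)) % p            ≡⟨ cong (λ t → (t + (p ∸ toℕ y)) % p) (toℕ-⊕ x y) ⟩
    ((toℕ x + toℕ y) % p + (p ∸ toℕ y)) % p    ≡⟨ [[x+m]%p+n]%p≡x x (toℕ y) (p ∸ toℕ y) (m+[n∸m]≡n (<⇒≤ (toℕ<n y))) ⟩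
    toℕ x                                      ∎)
    where open ≡-Reasoning

  ⊖-⊕-cancel : ∀ x y → (x ⊖ y) ⊕ y ≡ x
  ⊖-⊕-cancel x y = toℕ-injective (begin
    toℕ ((x ⊖ y) ⊕ y)                          ≡⟨ toℕ-⊕ (x ⊖ y) y ⟩
    (toℕ (x ⊖ y) + toℕ y) % p                  ≡⟨ cong (λ t → (t + toℕ y) % p) (toℕ-⊖ x y) ⟩
    ((toℕ x + (p ∸ toℕ y)) % p + toℕ y) % p    ≡⟨ [[x+m]%p+n]%p≡x x (p ∸ toℕ y) (toℕ y) (m∸n+n≡m (<⇒≤ (toℕ<n y))) ⟩
    toℕ x                                      ∎)
    where open ≡-Reasoning

  ⊖-⊕ : ∀ {x y z} w → z ≡ x ⊕ y → (w ⊖ z) ⊕ x ≡ w ⊖ y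
  ⊖-⊕ {x} {y} {z} w z≡x⊕y = begin
    (w ⊖ z) ⊕ x                ≡⟨ ⊕-⊖-cancel ((w ⊖ z) ⊕ x) y ⟨
    ((w ⊖ z) ⊕ x) ⊕ y ⊖ y      ≡⟨ cong (_⊖ y) (⊕-assoc (w ⊖ z) x y) ⟩
    (w ⊖ z) ⊕ (x ⊕ y) ⊖ y      ≡⟨ cong (λ t → (w ⊖ z) ⊕ t ⊖ y) z≡x⊕y ⟨
    (w ⊖ z) ⊕ z ⊖ y            ≡⟨ cong (_⊖ y) (⊖-⊕-cancel w z) ⟩
    w ⊖ y                      ∎
    where open ≡-Reasoning

  translation : Fin p → Permutation′ p
  translation t = permutation (_⊖ t) (_⊕ t) (λ x → ⊕-⊖-cancel x t) (λ x → ⊖-⊕-cancel x t)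

module _ {A : Set} where

  ∈⇒↭∷─ : ∀ {x : A} {xs} (x∈xs : x ∈ xs) → xs ↭ x ∷ (xs ─ x∈xs)
  ∈⇒↭∷─ (here refl) = ↭-refl
  ∈⇒↭∷─ {xs = y ∷ xs} (there x∈xs) = ↭-trans (↭.prep y (∈⇒↭∷─ x∈xs)) (↭.swap y _ ↭-refl)

  concatMap⁺ : ∀ {B : Set} (f : A → List B) {xs ys} → xs ↭ ys → concatMap f xs ↭ concatMap f ys
  concatMap⁺ f ↭.refl = ↭-refl
  concatMap⁺ f (↭.prep x xs↭ys) = ++⁺ˡ (f x) (concatMap⁺ f xs↭ys)
  concatMap⁺ f (↭.swap x y xs↭ys) = ↭-trans (++⁺ˡ (f x) (++⁺ˡ (f y) (concatMap⁺ f xs↭ys))) (shifts (f x) (f y))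
  concatMap⁺ f (↭.trans xs↭ys ys↭zs) = ↭-trans (concatMap⁺ f xs↭ys) (concatMap⁺ f ys↭zs)

  concat-tabulate-++ : ∀ {k} (f g : Fin k → List A)
    → concat (tabulate (λ i → f i ++ g i)) ↭ concat (tabulate f) ++ concat (tabulate g)
  concat-tabulate-++ {zero} f g = ↭-refl
  concat-tabulate-++ {suc k} f g = begin
    (f zero ++ g zero) ++ concat (tabulate (λ i → f (suc i) ++ g (suc i)))
      ≡⟨ ++-assoc (f zero) (g zero) _ ⟩
    f zero ++ g zero ++ concat (tabulate (λ i → f (suc i) ++ g (suc i)))
      ↭⟨ ++⁺ˡ (f zero) (++⁺ˡ (g zero) (concat-tabulate-++ (f ∘ suc) (g ∘ suc))) ⟩
    f zero ++ g zero ++ F ++ G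
      ↭⟨ ++⁺ˡ (f zero) (shifts (g zero) F) ⟩
    f zero ++ F ++ g zero ++ G
      ≡⟨ ++-assoc (f zero) F (g zero ++ G) ⟨
    (f zero ++ F) ++ g zero ++ G
      ∎
    where
    open ↭.PermutationReasoning
    F G : List A
    F = concat (tabulate (f ∘ suc))
    G = concat (tabulate (g ∘ suc))

  concat-tabulate-[] : ∀ {k} (f : Fin k → A) → concat (tabulate (λ i → [ f i ])) ≡ tabulate f
  concat-tabulate-[] {zero} f = refl
  concat-tabulate-[] {suc k} f = cong (f zero ∷_) (concat-tabulate-[] (f ∘ suc))

  concat-tabulate-triples : ∀ {k} (f g h : Fin k → A)
    → concat (tabulate (λ i → f i ∷ g i ∷ h i ∷ [])) ↭ tabulate f ++ tabulate g ++ tabulate h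
  concat-tabulate-triples f g h = begin
    concat (tabulate (λ i → [ f i ] ++ [ g i ] ++ [ h i ]))
      ↭⟨ concat-tabulate-++ ([_] ∘ f) (λ i → [ g i ] ++ [ h i ]) ⟩
    concat (tabulate ([_] ∘ f)) ++ concat (tabulate (λ i → [ g i ] ++ [ h i ]))
      ↭⟨ ++⁺ˡ (concat (tabulate ([_] ∘ f))) (concat-tabulate-++ ([_] ∘ g) ([_] ∘ h)) ⟩
    concat (tabulate ([_] ∘ f)) ++ concat (tabulate ([_] ∘ g)) ++ concat (tabulate ([_] ∘ h))
      ≡⟨ cong₂ _++_ (concat-tabulate-[] f) (cong₂ _++_ (concat-tabulate-[] g) (concat-tabulate-[] h)) ⟩
    tabulate f ++ tabulate g ++ tabulate h
      ∎
    where open ↭.PermutationReasoning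

  tabulate-punchIn : ∀ {k} (i : Fin (suc k)) (f : Fin (suc k) → A) → tabulate f ↭ f i ∷ tabulate (f ∘ punchIn i)
  tabulate-punchIn zero f = ↭-refl
  tabulate-punchIn {suc k} (suc i) f =
    ↭-trans (↭.prep (f zero) (tabulate-punchIn i (f ∘ suc))) (↭.swap (f zero) (f (suc i)) ↭-refl)

  tabulate-permute : ∀ {k} (π : Permutation′ k) (f : Fin k → A) → tabulate (f ∘ (π ⟨$⟩ʳ_)) ↭ tabulate f
  tabulate-permute {zero} π f = ↭-refl
  tabulate-permute {suc k} π f = ↭-trans
    (↭.prep (f (π ⟨$⟩ʳ zero)) (↭-trans
      (↭-reflexive (tabulate-cong (λ j → cong f (punchIn-permute π zero j))))
      (tabulate-permute (remove zero π) (f ∘ punchIn (π ⟨$⟩ʳ zero)))))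
    (↭-sym (tabulate-punchIn (π ⟨$⟩ʳ zero) f))

  Pointwise-↭-commute : ∀ {B : Set} {R : A → B → Set} {xs ys zs}
    → xs ↭ ys → Pointwise R ys zs → ∃ λ ws → Pointwise R xs ws × ws ↭ zs
  Pointwise-↭-commute {zs = zs} ↭.refl ys∼zs = zs , ys∼zs , ↭-refl
  Pointwise-↭-commute (↭.prep x xs↭ys) (_∷_ {y = z} r ys∼zs) with Pointwise-↭-commute xs↭ys ys∼zs
  ... | ws , xs∼ws , ws↭zs = z ∷ ws , r ∷ xs∼ws , ↭.prep z ws↭zs
  Pointwise-↭-commute (↭.swap x y xs↭ys) (_∷_ {y = z₁} r₁ (_∷_ {y = z₂} r₂ ys∼zs))
    with Pointwise-↭-commute xs↭ys ys∼zs
  ... | ws , xs∼ws , ws↭zs = z₂ ∷ z₁ ∷ ws , r₂ ∷ r₁ ∷ xs∼ws , ↭.swap z₂ z₁ ws↭zs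
  Pointwise-↭-commute (↭.trans xs↭ys ys↭zs) ys∼vs with Pointwise-↭-commute ys↭zs ys∼vs
  ... | us , ys∼us , us↭vs with Pointwise-↭-commute xs↭ys ys∼us
  ... | ws , xs∼ws , ws↭us = ws , xs∼ws , ↭-trans ws↭us us↭vs

relabel : {A B : Set} → (A → B) → A × A → B × B
relabel f (x , y) = (f x , f y)

spokes : {A : Set} → A → A → A → A → List (A × A)
spokes w x y z = (w , x) ∷ (w , y) ∷ (w , z) ∷ []

spokeEdges : ∀ {n k} {V : Set} → (Fin n ⊎ Fin k → V) → (X Y Z : Fin k → Fin n) → List (V × V)
spokeEdges f X Y Z =
  concat (tabulate λ j → spokes (f (inj₂ j)) (f (inj₁ (X j))) (f (inj₁ (Y j))) (f (inj₁ (Z j))))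

-- The new vertex of the first move is an old vertex for the remaining moves.
⊎-moveTop : ∀ {n k} → (Fin n ⊎ Fin (suc k)) ↔ (Fin (suc n) ⊎ Fin k)
⊎-moveTop {n} {k} = mk↔ₛ′ to from to∘from from∘to
  where
  to : Fin n ⊎ Fin (suc k) → Fin (suc n) ⊎ Fin k
  to (inj₁ i) = inj₁ (inject₁ i)
  to (inj₂ zero) = inj₁ (fromℕ n)
  to (inj₂ (suc j)) = inj₂ j

  fromView : {u : Fin (suc n)} → View u → Fin n ⊎ Fin (suc k)
  fromView ‵fromℕ = inj₂ zero
  fromView (‵inj₁ {i = i} _) = inj₁ i

  from : Fin (suc n) ⊎ Fin k → Fin n ⊎ Fin (suc k)
  from (inj₁ u) = fromView (view u)
  from (inj₂ j) = inj₂ (suc j)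

  to∘fromView : ∀ {u} (v : View u) → to (fromView v) ≡ inj₁ u
  to∘fromView ‵fromℕ = refl
  to∘fromView (‵inj₁ _) = refl

  to∘from : ∀ s → to (from s) ≡ s
  to∘from (inj₁ u) = to∘fromView (view u)
  to∘from (inj₂ j) = refl

  from∘to : ∀ s → from (to s) ≡ s
  from∘to (inj₁ i) = cong fromView (view-inject₁ i)
  from∘to (inj₂ zero) = cong fromView (view-fromℕ n)
  from∘to (inj₂ (suc j)) = refl

H2-edges : ∀ (U : UGraph) {x y} (xy∈U : (x , y) ∈ UGraph.edges U) z {rest}
  → UGraph.edges U ↭ (x , y) ∷ rest
  → UGraph.edges (H2 U xy∈U z)
    ↭ map injE rest ++ spokes (fromℕ (UGraph.nV U)) (inject₁ x) (inject₁ y) (inject₁ z)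
H2-edges U xy∈U z U↭ = ++⁺ʳ _ (map⁺ injE (drop-∷ (↭-trans (↭-sym (∈⇒↭∷─ xy∈U)) U↭)))

record H2Run (U : UGraph) {k : ℕ} (X Y Z : Fin k → Fin (UGraph.nV U))
             (R : List (Fin (UGraph.nV U) × Fin (UGraph.nV U))) : Set where
  field
    result   : UGraph
    moves    : H2Moves U (tabulate (λ j → X j , Y j)) result
    vertices : (Fin (UGraph.nV U) ⊎ Fin k) ↔ Fin (UGraph.nV result)
    edges↭   : UGraph.edges result
               ↭ map (relabel (Inverse.to vertices ∘ inj₁)) R ++ spokeEdges (Inverse.to vertices) X Y Z

h2-run : ∀ k (U : UGraph) (X Y Z : Fin k → Fin (UGraph.nV U)) R
       → UGraph.edges U ↭ tabulate (λ j → X j , Y j) ++ R → H2Run U X Y Z R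
h2-run zero U X Y Z R U↭R = record
  { result   = U
  ; moves    = done
  ; vertices = mk↔ₛ′ (λ { (inj₁ i) → i ; (inj₂ ()) }) inj₁ (λ _ → refl) (λ { (inj₁ _) → refl ; (inj₂ ()) })
  ; edges↭   = ↭-trans U↭R (↭-reflexive (sym (trans (++-identityʳ _) (map-id R))))
  }
h2-run (suc k) U X Y Z R U↭R = record
  { result   = result
  ; moves    = step x₀y₀∈U (Z zero) _ (subst (λ rs → H2Moves U₁ rs result) (sym (map-tabulate _ injE)) moves)
  ; vertices = vertices ↔-∘ ⊎-moveTop
  ; edges↭   = ↭-trans edges↭ (↭-reflexive (begin
      map (relabel old₁) (map injE R ++ W) ++ S₁
        ≡⟨ cong (_++ S₁) (map-++ (relabel old₁) (map injE R) W) ⟩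
      (map (relabel old₁) (map injE R) ++ map (relabel old₁) W) ++ S₁
        ≡⟨ ++-assoc (map (relabel old₁) (map injE R)) _ S₁ ⟩
      map (relabel old₁) (map injE R) ++ map (relabel old₁) W ++ S₁
        ≡⟨ cong (_++ map (relabel old₁) W ++ S₁) (map-∘ R) ⟨
      map (relabel (old₁ ∘ inject₁)) R ++ map (relabel old₁) W ++ S₁ ∎))
  }
  where
  open ≡-Reasoning
  n : ℕ
  n = UGraph.nV U
  x₀y₀∈U : (X zero , Y zero) ∈ UGraph.edges U
  x₀y₀∈U = ∈-resp-↭ (↭-sym U↭R) (here refl)
  U₁ : UGraph
  U₁ = H2 U x₀y₀∈U (Z zero)
  W : List (Fin (suc n) × Fin (suc n))
  W = spokes (fromℕ n) (inject₁ (X zero)) (inject₁ (Y zero)) (inject₁ (Z zero))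
  X₁ Y₁ Z₁ : Fin k → Fin (suc n)
  X₁ = inject₁ ∘ X ∘ suc
  Y₁ = inject₁ ∘ Y ∘ suc
  Z₁ = inject₁ ∘ Z ∘ suc
  U₁↭R₁ : UGraph.edges U₁ ↭ tabulate (λ j → X₁ j , Y₁ j) ++ (map injE R ++ W)
  U₁↭R₁ = ↭-trans (H2-edges U x₀y₀∈U (Z zero) U↭R) (↭-reflexive (begin
      map injE (tabulate (λ j → X (suc j) , Y (suc j)) ++ R) ++ W
        ≡⟨ cong (_++ W) (map-++ injE (tabulate (λ j → X (suc j) , Y (suc j))) R) ⟩
      (map injE (tabulate (λ j → X (suc j) , Y (suc j))) ++ map injE R) ++ W
        ≡⟨ cong (λ xs → (xs ++ map injE R) ++ W) (map-tabulate _ injE) ⟩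
      (tabulate (λ j → X₁ j , Y₁ j) ++ map injE R) ++ W
        ≡⟨ ++-assoc (tabulate (λ j → X₁ j , Y₁ j)) (map injE R) W ⟩
      tabulate (λ j → X₁ j , Y₁ j) ++ map injE R ++ W ∎))
  open H2Run (h2-run k U₁ X₁ Y₁ Z₁ (map injE R ++ W) U₁↭R₁)
  old₁ : Fin (suc n) → Fin (UGraph.nV result)
  old₁ = Inverse.to vertices ∘ inj₁
  S₁ : List (Fin (UGraph.nV result) × Fin (UGraph.nV result))
  S₁ = spokeEdges (Inverse.to vertices) X₁ Y₁ Z₁

blocks : ∀ n m → (Fin (n * m) ⊎ Fin m) ↔ Fin (suc n * m)
blocks n m = cast-id (+-comm (n * m) m) ↔-∘ ↔-sym +↔⊎

module _ {n m : ℕ} where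

  blocks-inj₁ : ∀ (i : Fin n) (δ : Fin m) → Inverse.to (blocks n m) (inj₁ (combine i δ)) ≡ combine (inject₁ i) δ
  blocks-inj₁ i δ = toℕ-injective (begin
    toℕ (Inverse.to (blocks n m) (inj₁ (combine i δ)))  ≡⟨ toℕ-cast _ (combine i δ ↑ˡ m) ⟩
    toℕ (combine i δ ↑ˡ m)                              ≡⟨ toℕ-↑ˡ (combine i δ) m ⟩
    toℕ (combine i δ)                                   ≡⟨ toℕ-combine i δ ⟩
    m * toℕ i + toℕ δ                                   ≡⟨ cong (λ t → m * t + toℕ δ) (toℕ-inject₁ i) ⟨
    m * toℕ (inject₁ i) + toℕ δ                         ≡⟨ toℕ-combine (inject₁ i) δ ⟨
    toℕ (combine (inject₁ i) δ)                         ∎)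
    where open ≡-Reasoning

  blocks-inj₂ : ∀ (δ : Fin m) → Inverse.to (blocks n m) (inj₂ δ) ≡ combine (fromℕ n) δ
  blocks-inj₂ δ = toℕ-injective (begin
    toℕ (Inverse.to (blocks n m) (inj₂ δ))  ≡⟨ toℕ-cast _ (n * m ↑ʳ δ) ⟩
    toℕ (n * m ↑ʳ δ)                        ≡⟨ toℕ-↑ʳ (n * m) δ ⟩
    n * m + toℕ δ                           ≡⟨ cong (_+ toℕ δ) (*-comm n m) ⟩
    m * n + toℕ δ                           ≡⟨ cong (λ t → m * t + toℕ δ) (toℕ-fromℕ n) ⟨
    m * toℕ (fromℕ n) + toℕ δ               ≡⟨ toℕ-combine (fromℕ n) δ ⟨
    toℕ (combine (fromℕ n) δ)               ∎)
    where open ≡-Reasoning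

module _ {p : ℕ} .{{_ : NonZero p}} where

  map-allFin-translate : ∀ {A : Set} t (f : Fin p → A) → map f (allFin p) ↭ tabulate (f ∘ (_⊖ t))
  map-allFin-translate t f = begin
    map f (allFin p)        ≡⟨ map-tabulate id f ⟩
    tabulate f              ↭⟨ tabulate-permute (translation t) f ⟨
    tabulate (f ∘ (_⊖ t))   ∎
    where open ↭.PermutationReasoning

  fiber-byHead : ∀ {n} (x y : Fin n) γ → fiber x y γ ↭ tabulate (λ η → combine x (η ⊖ γ) , combine y η)
  fiber-byHead x y γ = ↭-trans (map-allFin-translate γ _)
    (↭-reflexive (tabulate-cong (λ η → cong (λ δ → combine x (η ⊖ γ) , combine y δ) (⊖-⊕-cancel η γ))))

  relabel₃ : ∀ {m n} → (Fin m → Fin n) → Fin m × Fin m × Fin p → Fin n × Fin n × Fin p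
  relabel₃ g (i , j , γ) = (g i , g j , γ)

  map-relabel-lift : ∀ {m n} (g : Fin m → Fin n) (ĝ : Fin (m * p) → Fin (n * p))
    → (∀ i δ → ĝ (combine i δ) ≡ combine (g i) δ)
    → ∀ es → map (relabel ĝ) (concatMap liftEdge es) ≡ concatMap liftEdge (map (relabel₃ g) es)
  map-relabel-lift g ĝ ĝ-combine [] = refl
  map-relabel-lift g ĝ ĝ-combine ((i , j , γ) ∷ es) = begin
    map (relabel ĝ) (fiber i j γ ++ concatMap liftEdge es)
      ≡⟨ map-++ (relabel ĝ) (fiber i j γ) _ ⟩
    map (relabel ĝ) (fiber i j γ) ++ map (relabel ĝ) (concatMap liftEdge es)
      ≡⟨ cong₂ _++_ fiber-relabel (map-relabel-lift g ĝ ĝ-combine es) ⟩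
    fiber (g i) (g j) γ ++ concatMap liftEdge (map (relabel₃ g) es)
      ∎
    where
    open ≡-Reasoning
    fiber-relabel : map (relabel ĝ) (fiber i j γ) ≡ fiber (g i) (g j) γ
    fiber-relabel = trans (sym (map-∘ (allFin p)))
      (map-cong (λ δ → cong₂ _,_ (ĝ-combine i δ) (ĝ-combine j (δ ⊕ γ))) (allFin p))

Iso-intro : ∀ {G H : UGraph} (φ : Fin (UGraph.nV G) ↔ Fin (UGraph.nV H)) xs ys
  → UGraph.edges G ↭ xs ++ ys
  → map (relabel (Inverse.to φ)) xs ++ map (swap ∘ relabel (Inverse.to φ)) ys ↭ UGraph.edges H
  → Iso G H
Iso-intro {G} {H} φ xs ys G↭xs++ys ↭H =
  let ws , related , ws↭ = Pointwise-↭-commute φG↭ oriented in φ , ws , related , ↭-trans ws↭ ↭H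
  where
  f : Fin (UGraph.nV G) → Fin (UGraph.nV H)
  f = Inverse.to φ
  φG↭ : map (relabel f) (UGraph.edges G) ↭ map (relabel f) xs ++ map (relabel f) ys
  φG↭ = ↭-trans (map⁺ (relabel f) G↭xs++ys) (↭-reflexive (map-++ (relabel f) xs ys))
  oriented : Pointwise UEdgeEq (map (relabel f) xs ++ map (relabel f) ys)
                               (map (relabel f) xs ++ map (swap ∘ relabel f) ys)
  oriented = Pointwise.++⁺ (Pointwise.refl (inj₁ (refl , refl)))
    (Pointwise.map⁺ (relabel f) (swap ∘ relabel f) (Pointwise.refl (inj₂ (refl , refl)) {ys}))

module _ {p : ℕ} .{{_ : NonZero p}} (G : CGraph p) {a b : Fin (CGraph.nV G)} {γab : Fin p}
         (ab∈G : (a , b , γab) ∈ CGraph.edges G) (c : Fin (CGraph.nV G)) (γan γbn γcn : Fin p)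
         (γan≡γab⊕γbn : γan ≡ γab ⊕ γbn) where

  private
    n : ℕ
    n = CGraph.nV G
    H : CGraph p
    H = H2c G ab∈G c γan γbn γcn
    R : List (Fin (n * p) × Fin (n * p))
    R = concatMap liftEdge (CGraph.edges G ─ ab∈G)
    ñ : Fin p → Fin (suc n * p)
    ñ = combine (fromℕ n)

    X Y Z : Fin p → Fin (n * p)
    X η = combine a (η ⊖ γan)
    Y η = combine b (η ⊖ γbn)
    Z η = combine c (η ⊖ γcn)

  fiber↭removed : fiber a b γab ↭ tabulate (λ η → X η , Y η)
  fiber↭removed = ↭-trans (map-allFin-translate γan _) (↭-reflexive (tabulate-cong
    (λ η → cong (λ δ → X η , combine b δ) (⊖-⊕ η γan≡γab⊕γbn))))

  private
    liftG↭ : UGraph.edges (lift G) ↭ tabulate (λ η → X η , Y η) ++ R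
    liftG↭ = ↭-trans (concatMap⁺ liftEdge (∈⇒↭∷─ ab∈G)) (++⁺ʳ R fiber↭removed)

  open H2Run (h2-run p (lift G) X Y Z R liftG↭)

  private
    ι : Fin (n * p) ⊎ Fin p → Fin (UGraph.nV result)
    ι = Inverse.to vertices

    φ : Fin (UGraph.nV result) ↔ Fin (suc n * p)
    φ = blocks n p ↔-∘ ↔-sym vertices

    φ∘ι : ∀ s → Inverse.to φ (ι s) ≡ Inverse.to (blocks n p) s
    φ∘ι s = cong (Inverse.to (blocks n p)) (Inverse.strictlyInverseʳ vertices s)

    φ-old : ∀ i δ → Inverse.to φ (ι (inj₁ (combine i δ))) ≡ combine (inject₁ i) δ
    φ-old i δ = trans (φ∘ι (inj₁ (combine i δ))) (blocks-inj₁ {n} {p} i δ)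

    φ-new : ∀ η → Inverse.to φ (ι (inj₂ η)) ≡ ñ η
    φ-new η = trans (φ∘ι (inj₂ η)) (blocks-inj₂ {n} {p} η)

    fiberEdge : Fin n → Fin p → Fin p → Fin (suc n * p) × Fin (suc n * p)
    fiberEdge x γ η = combine (inject₁ x) (η ⊖ γ) , ñ η

    φ-spoke : ∀ x γ η → swap (relabel (Inverse.to φ) (ι (inj₂ η) , ι (inj₁ (combine x (η ⊖ γ)))))
                        ≡ fiberEdge x γ η
    φ-spoke x γ η = cong₂ _,_ (φ-old x (η ⊖ γ)) (φ-new η)

    old-edges : map (relabel (Inverse.to φ)) (map (relabel (ι ∘ inj₁)) R)
                ≡ concatMap liftEdge (map (relabel₃ inject₁) (CGraph.edges G ─ ab∈G))
    old-edges = trans (sym (map-∘ R)) (map-relabel-lift inject₁ _ φ-old (CGraph.edges G ─ ab∈G))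

    new-edges : map (swap ∘ relabel (Inverse.to φ)) (spokeEdges ι X Y Z)
                ↭ fiber (inject₁ a) (fromℕ n) γan ++ fiber (inject₁ b) (fromℕ n) γbn
                  ++ fiber (inject₁ c) (fromℕ n) γcn ++ []
    new-edges = begin
      map (swap ∘ relabel (Inverse.to φ)) (concat (tabulate spokesAt))
        ≡⟨ concat-map (tabulate spokesAt) ⟨
      concat (map (map (swap ∘ relabel (Inverse.to φ))) (tabulate spokesAt))
        ≡⟨ cong concat (map-tabulate spokesAt (map (swap ∘ relabel (Inverse.to φ)))) ⟩
      concat (tabulate (map (swap ∘ relabel (Inverse.to φ)) ∘ spokesAt))
        ≡⟨ cong concat (tabulate-cong (λ η →
             cong₂ _∷_ (φ-spoke a γan η) (cong₂ _∷_ (φ-spoke b γbn η) (cong₂ _∷_ (φ-spoke c γcn η) refl)))) ⟩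
      concat (tabulate (λ η → fiberEdge a γan η ∷ fiberEdge b γbn η ∷ fiberEdge c γcn η ∷ []))
        ↭⟨ concat-tabulate-triples (fiberEdge a γan) (fiberEdge b γbn) (fiberEdge c γcn) ⟩
      tabulate (fiberEdge a γan) ++ tabulate (fiberEdge b γbn) ++ tabulate (fiberEdge c γcn)
        ↭⟨ ++⁺ (fiber↭ a γan) (++⁺ (fiber↭ b γbn) (↭-trans (fiber↭ c γcn) (↭-reflexive (sym (++-identityʳ _))))) ⟩
      fiber (inject₁ a) (fromℕ n) γan ++ fiber (inject₁ b) (fromℕ n) γbn ++ fiber (inject₁ c) (fromℕ n) γcn ++ []
        ∎
      where
      open ↭.PermutationReasoning
      spokesAt : Fin p → List (Fin (UGraph.nV result) × Fin (UGraph.nV result))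
      spokesAt η = spokes (ι (inj₂ η)) (ι (inj₁ (X η))) (ι (inj₁ (Y η))) (ι (inj₁ (Z η)))
      fiber↭ : ∀ x γ → tabulate (fiberEdge x γ) ↭ fiber (inject₁ x) (fromℕ n) γ
      fiber↭ x γ = ↭-sym (fiber-byHead (inject₁ x) (fromℕ n) γ)

    liftH↭ : map (relabel (Inverse.to φ)) (map (relabel (ι ∘ inj₁)) R)
             ++ map (swap ∘ relabel (Inverse.to φ)) (spokeEdges ι X Y Z)
             ↭ UGraph.edges (lift H)
    liftH↭ = ↭-trans (++⁺ (↭-reflexive old-edges) new-edges)
      (↭-reflexive (sym (concatMap-++ liftEdge (map (relabel₃ inject₁) (CGraph.edges G ─ ab∈G)) _)))

  lift-H2c : ∃ λ rs → (rs ↭ fiber a b γab) × ∃ λ G' → H2Moves (lift G) rs G' × Iso G' (lift H)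
  lift-H2c = tabulate (λ η → X η , Y η) , ↭-sym fiber↭removed ,
             result , moves , Iso-intro φ (map (relabel (ι ∘ inj₁)) R) (spokeEdges ι X Y Z) edges↭ liftH↭

lemma9 : (p : ℕ) → Prime p → ¬ (2 ∣ p) → .{{_ : NonZero p}}
  → (G : CGraph p) {a b : Fin (CGraph.nV G)} {γab : Fin p}
  → (e : (a , b , γab) ∈ CGraph.edges G) (c : Fin (CGraph.nV G))
  → (γan γbn γcn : Fin p)
  → γan ≡ γab ⊕ γbn
  → (a ≡ b → γan ≢ γbn) → (a ≡ c → γan ≢ γcn) → (b ≡ c → γbn ≢ γcn)
  → ∃ λ rs → (rs ↭ fiber a b γab)
    × ∃ λ G' → H2Moves (lift G) rs G' × Iso G' (lift (H2c G e c γan γbn γcn))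
lemma9 p _ _ G e c γan γbn γcn γan≡γab⊕γbn _ _ _ = lift-H2c G e c γan γbn γcn γan≡γab⊕γbn
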